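{- Let $G$ be a simple, finite, connected partial 2-tree with edge weights $w:E(G)\to\mathbb{N}$ and a total order on $V(G)$, which is not outerplanar. Let $u,v\in V(G)$ be such that $G$ contains a subdivision of $K_{2,3}$ with branch-vertex bipartition $(\{u,v\},\{x,y,z\})$ and $G-\{u,v\}$ has at least three components. Let $P=lsp(u,v)$ and let $H$ be a component of $G-\{u,v\}$ with $V(P)\cap V(H)=\emptyset$ and $E(P)\cap E(H)=\emptyset$. Let $G_1$ be the graph with $V(G_1)=V(H)\cup V(P)$ and $E(G_1)=E(H)\cup E(P)\cup\{(a,b)\in E(G): a\in V(H), b\in\{u,v\}\}$, and let $G_2=G[V(G)\setminus V(H)]$. Then for each $i\in\{1,2\}$ and every two vertices $a,b\in V(G_i)$, the path $lsp(a,b)$ (taken in $G$) is contained in $G_i$.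
   Context: A partial 2-tree is a subgraph of a 2-tree, where 2-trees are built from $K_3$ by repeatedly adding a vertex adjacent to both endpoints of an existing edge. For a path $Q$, $w(Q)=\sum_{e\in E(Q)}w(e)$. The lex shortest path $lsp(a,b)$ in $G$ is the unique $a$–$b$ path $Q$ such that for every other $a$–$b$ path $Q'$ exactly one of: (1) $w(Q')>w(Q)$; (2) $w(Q')=w(Q)$ and $|E(Q')|>|E(Q)|$; (3) $w(Q')=w(Q)$, $|E(Q')|=|E(Q)|$ and $\min(V(Q')\setminus V(Q))>\min(V(Q)\setminus V(Q'))$. $G[X]$ denotes the induced subgraph on $X$. -}

module Defs where

open import Data.Nat using (ℕ; zero; suc; _+_; _∸_) renaming (_<_ to _<ℕ_)
open import Data.Fin using (Fin; zero; suc; _≤_; _<_; _≟_; #_)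
open import Data.Bool using (Bool; true; false; T; not; _∨_)
open import Data.List using (List; []; _∷_; length; lookup)
open import Data.List.Membership.Propositional using (_∈_; _∉_)
open import Data.List.Relation.Unary.All using (All)
open import Data.List.Relation.Unary.Unique.Propositional using (Unique)
open import Data.Product using (Σ; ∃; _×_; _,_; proj₁; proj₂)
open import Data.Sum using (_⊎_)
open import Data.Empty using (⊥)
open import Data.Unit using (⊤; tt)
open import Data.Vec as Vec using (Vec)
open import Relation.Nullary using (¬_)
open import Relation.Nullary.Decidable using (⌊_⌋)
open import Relation.Binary.PropositionalEquality using (_≡_; _≢_)
open import Function.Definitions using (Injective)

-- Simple finite graphs on vertex set Fin n.  The total order on V(G)
-- is the natural order of Fin n.

record Graph (n : ℕ) : Set where
  field
    adj   : Fin n → Fin n → Bool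
    sym   : ∀ x y → adj x y ≡ adj y x
    irrefl : ∀ x → adj x x ≡ false

open Graph public

Adj : ∀ {n} → Graph n → Fin n → Fin n → Set
Adj G x y = T (adj G x y)

-- Edge weights w : E(G) → ℕ, represented by a function on ordered pairs
-- that is symmetric on edges (values on non-edges are irrelevant).
Weights : ℕ → Set
Weights n = Fin n → Fin n → ℕ

SymOnEdges : ∀ {n} → Graph n → Weights n → Set
SymOnEdges G w = ∀ x y → Adj G x y → w x y ≡ w y x

data IsWalk {n} (G : Graph n) : Fin n → Fin n → List (Fin n) → Set where
  single : ∀ a → IsWalk G a a (a ∷ [])
  cons   : ∀ {a b c vs} → Adj G a b → IsWalk G b c vs → IsWalk G a c (a ∷ vs)

IsPath : ∀ {n} → Graph n → Fin n → Fin n → List (Fin n) → Set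
IsPath G a b vs = IsWalk G a b vs × Unique vs

pathWeight : ∀ {n} → Weights n → List (Fin n) → ℕ
pathWeight w (x ∷ y ∷ r) = w x y + pathWeight w (y ∷ r)
pathWeight w _ = 0

numEdges : ∀ {n} → List (Fin n) → ℕ
numEdges vs = length vs ∸ 1

data Consec {n} : List (Fin n) → Fin n → Fin n → Set where
  here  : ∀ {x y r} → Consec (x ∷ y ∷ r) x y
  there : ∀ {z r x y} → Consec r x y → Consec (z ∷ r) x y

PathEdge : ∀ {n} → List (Fin n) → Fin n → Fin n → Set
PathEdge vs a b = Consec vs a b ⊎ Consec vs b a

IsMinOf : ∀ {n} → (Fin n → Set) → Fin n → Set
IsMinOf S m = S m × (∀ s → S s → m ≤ s)

Diff : ∀ {n} → List (Fin n) → List (Fin n) → Fin n → Set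
Diff Q Q' x = x ∈ Q × x ∉ Q'

LexWorse : ∀ {n} → Weights n → List (Fin n) → List (Fin n) → Set
LexWorse w Q Q' =
  (pathWeight w Q <ℕ pathWeight w Q')
  ⊎ ((pathWeight w Q' ≡ pathWeight w Q) × (numEdges Q <ℕ numEdges Q'))
  ⊎ ((pathWeight w Q' ≡ pathWeight w Q) × (numEdges Q' ≡ numEdges Q)
      × Σ (Fin _) λ m' → Σ (Fin _) λ m →
          IsMinOf (Diff Q' Q) m' × IsMinOf (Diff Q Q') m × m < m')

IsLSP : ∀ {n} → Graph n → Weights n → Fin n → Fin n → List (Fin n) → Set
IsLSP G w a b Q =
  IsPath G a b Q × (∀ Q' → IsPath G a b Q' → Q' ≢ Q → LexWorse w Q Q')

data ReachIn {n} (G : Graph n) (allowed : Fin n → Set) : Fin n → Fin n → Set where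
  here : ∀ {x} → allowed x → ReachIn G allowed x x
  step : ∀ {x y z} → allowed x → Adj G x y → ReachIn G allowed y z →
         ReachIn G allowed x z

Connected : ∀ {n} → Graph n → Set
Connected G = ∀ a b → ReachIn G (λ _ → ⊤) a b

Outside : ∀ {n} → Fin n → Fin n → Fin n → Set
Outside u v x = x ≢ u × x ≢ v

-- Subdivisions of a pattern graph on Fin k with edge list es, with the
-- branch vertices given by β.

Internal : ∀ {n} → Fin n → Fin n → List (Fin n) → Fin n → Set
Internal a b vs x = x ∈ vs × x ≢ a × x ≢ b

record Subdivision {n} (G : Graph n) (k : ℕ) (es : List (Fin k × Fin k))
                   (β : Fin k → Fin n) : Set where
  field
    β-inj   : Injective _≡_ _≡_ β
    path    : Fin (length es) → List (Fin n)
    isPath  : ∀ e → IsPath G (β (proj₁ (lookup es e))) (β (proj₂ (lookup es e))) (path e)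
    intNotBranch : ∀ e x → Internal (β (proj₁ (lookup es e))) (β (proj₂ (lookup es e))) (path e) x →
                   ∀ i → x ≢ β i
    intDisjoint : ∀ e e' → e ≢ e' → ∀ x →
                  Internal (β (proj₁ (lookup es e))) (β (proj₂ (lookup es e))) (path e) x →
                  x ∉ path e'

K4edges : List (Fin 4 × Fin 4)
K4edges = (# 0 , # 1) ∷ (# 0 , # 2) ∷ (# 0 , # 3) ∷ (# 1 , # 2) ∷ (# 1 , # 3) ∷ (# 2 , # 3) ∷ []

K23edges : List (Fin 5 × Fin 5)
K23edges = (# 0 , # 2) ∷ (# 0 , # 3) ∷ (# 0 , # 4) ∷ (# 1 , # 2) ∷ (# 1 , # 3) ∷ (# 1 , # 4) ∷ []

HasK23Subdivision : ∀ {n} → Graph n → Fin n → Fin n → Fin n → Fin n → Fin n → Set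
HasK23Subdivision G u v x y z =
  Subdivision G 5 K23edges (Vec.lookup (u Vec.∷ v Vec.∷ x Vec.∷ y Vec.∷ z Vec.∷ Vec.[]))

-- Outerplanarity via the Chartrand–Harary characterisation: no
-- subdivision of K4 and no subdivision of K_{2,3}.
Outerplanar : ∀ {n} → Graph n → Set
Outerplanar G = (¬ Σ _ λ β → Subdivision G 4 K4edges β)
              × (¬ Σ _ λ β → Subdivision G 5 K23edges β)

-- 2-trees.  Vertex 0 is the newly added vertex, old ones are shifted.

_==_ : ∀ {m} → Fin m → Fin m → Bool
x == y = ⌊ x ≟ y ⌋

K3 : Fin 3 → Fin 3 → Bool
K3 x y = not (x == y)

extend : ∀ {m} → (Fin m → Fin m → Bool) → Fin m → Fin m → Fin (suc m) → Fin (suc m) → Bool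
extend E a b zero    zero    = false
extend E a b zero    (suc y) = (y == a) ∨ (y == b)
extend E a b (suc x) zero    = (x == a) ∨ (x == b)
extend E a b (suc x) (suc y) = E x y

data TwoTree : (m : ℕ) → (Fin m → Fin m → Bool) → Set where
  triangle : TwoTree 3 K3
  add      : ∀ {m E} → TwoTree m E → ∀ a b → T (E a b) → TwoTree (suc m) (extend E a b)

Partial2Tree : ∀ {n} → Graph n → Set
Partial2Tree {n} G =
  Σ ℕ λ m → Σ (Fin m → Fin m → Bool) λ E → TwoTree m E ×
  Σ (Fin n → Fin m) λ f → Injective _≡_ _≡_ f × (∀ x y → Adj G x y → T (E (f x) (f y)))

AtLeast3Components : ∀ {n} → Graph n → Fin n → Fin n → Set
AtLeast3Components G u v =
  Σ _ λ x₁ → Σ _ λ x₂ → Σ _ λ x₃ →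
  Outside u v x₁ × Outside u v x₂ × Outside u v x₃ ×
  ¬ ReachIn G (Outside u v) x₁ x₂ × ¬ ReachIn G (Outside u v) x₁ x₃ ×
  ¬ ReachIn G (Outside u v) x₂ x₃

InH : ∀ {n} → Graph n → Fin n → Fin n → Fin n → Fin n → Set
InH G u v h x = ReachIn G (Outside u v) h x

EdgeH : ∀ {n} → Graph n → Fin n → Fin n → Fin n → Fin n → Fin n → Set
EdgeH G u v h a b = Adj G a b × InH G u v h a × InH G u v h b

V₁ : ∀ {n} → Graph n → Fin n → Fin n → Fin n → List (Fin n) → Fin n → Set
V₁ G u v h P x = InH G u v h x ⊎ x ∈ P

E₁ : ∀ {n} → Graph n → Fin n → Fin n → Fin n → List (Fin n) → Fin n → Fin n → Set
E₁ G u v h P a b =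
  EdgeH G u v h a b
  ⊎ PathEdge P a b
  ⊎ (Adj G a b × ((InH G u v h a × (b ≡ u ⊎ b ≡ v)) ⊎ (InH G u v h b × (a ≡ u ⊎ a ≡ v))))

V₂ : ∀ {n} → Graph n → Fin n → Fin n → Fin n → Fin n → Set
V₂ G u v h x = ¬ InH G u v h x

E₂ : ∀ {n} → Graph n → Fin n → Fin n → Fin n → Fin n → Fin n → Set
E₂ G u v h a b = Adj G a b × V₂ G u v h a × V₂ G u v h b

ContainedIn : ∀ {n} → List (Fin n) → (Fin n → Set) → (Fin n → Fin n → Set) → Set
ContainedIn Q VS ES = All VS Q × (∀ a b → PathEdge Q a b → ES a b)

-- Two properties of lex shortest paths drive the proof: they are unique, and every segment
-- of an lsp is the lsp between its ends. (Splicing a better path into lsp(a,b) in place of the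
-- segment gives an a–b walk; if it is a path it would beat lsp(a,b), and if not, shortcutting
-- it to a path makes it no heavier and strictly shorter, which beats lsp(a,b) as well.) Hence
-- an lsp between two vertices of P = lsp(u,v) is a segment of P. Now let c ∉ V(P) lie on
-- Q = lsp(a,b). If Q met P both before and after c, the segment of Q between the two meeting
-- points would be a segment of P containing c; so one side of c on Q avoids V(P) ⊇ {u,v}, and c
-- lies in the component of G − {u,v} containing a or b. For G₁ this puts c in H; for G₂, whose
-- vertices avoid H, it keeps c out of H. Finally, an edge of Q with both ends on P is a
-- one-edge segment, hence an edge of P.

module Submission where

open import Defs hiding (sym)
open import Data.Nat using (ℕ; suc; _+_; _∸_; s≤s) renaming (_<_ to _<ℕ_; _≤_ to _≤ℕ_)
open import Data.Nat.Properties
  using (≤-refl; ≤-trans; ≤-reflexive; <⇒≤; <-irrefl; ≤⇒≯; ≤-<-trans; <-≤-trans; <-trans; ≤-antisym;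
         m≤n⇒m<n∨m≡n; m≤n+m; +-monoʳ-≤; +-cancelˡ-<; +-cancelˡ-≡; +-assoc; +-comm; +-suc; +-identityʳ;
         +-commutativeSemigroup)
open import Algebra.Properties.CommutativeSemigroup +-commutativeSemigroup using (x∙yz≈xz∙y)
open import Data.Fin using (Fin; _≟_)
open import Data.List using (List; []; _∷_; _++_; length; reverse; [_])
open import Data.List.Properties
  using (++-assoc; unfold-reverse; reverse-selfInverse; reverse-involutive; length-++; length-reverse; ≡-dec;
         ++-cancelˡ; ++-cancelʳ)
open import Data.List.Membership.Propositional using (_∈_; _∉_; find)
open import Data.List.Membership.Propositional.Properties using (∈-∃++; ∈-++⁺ˡ; ∈-++⁺ʳ; ∈-++⁻)
import Data.List.Membership.DecPropositional as DecMembership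
open import Data.List.Relation.Unary.Any using (here; there; any?)
import Data.List.Relation.Unary.Any.Properties as Any
open import Data.List.Relation.Unary.All as All using (All; []; _∷_)
import Data.List.Relation.Unary.All.Properties as All
open import Data.List.Relation.Unary.AllPairs using ([]; _∷_)
open import Data.List.Relation.Unary.Unique.Propositional using (Unique)
import Data.List.Relation.Unary.Unique.DecPropositional as DecUnique
import Data.List.Relation.Binary.Permutation.Setoid as Perm
open import Data.List.Relation.Binary.Permutation.Setoid.Properties using (Unique-resp-↭; ↭-reverse)
open import Data.Product using (Σ; ∃; _×_; _,_; proj₁; proj₂)
open import Data.Sum using (_⊎_; inj₁; inj₂; [_,_]′)
open import Data.Empty using (⊥-elim)
open import Data.Bool using (T)
open import Function using (_∘_)
open import Relation.Nullary using (¬_; yes; no)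
open import Relation.Unary using (_≐_)
open import Relation.Unary.Properties using (≐-sym)
open import Relation.Binary.PropositionalEquality hiding ([_])

module _ {A : Set} where

  Unique-∷ : ∀ {x : A} {xs} → x ∉ xs → Unique xs → Unique (x ∷ xs)
  Unique-∷ {xs = xs} x∉ u = All.¬Any⇒All¬ xs x∉ ∷ u

  Unique-++⁻ˡ : ∀ (X : List A) {Y} → Unique (X ++ Y) → Unique X
  Unique-++⁻ˡ []      _         = []
  Unique-++⁻ˡ (_ ∷ X) (x∉ ∷ u) = All.++⁻ˡ X x∉ ∷ Unique-++⁻ˡ X u

  Unique-++⁻ʳ : ∀ (X : List A) {Y} → Unique (X ++ Y) → Unique Y
  Unique-++⁻ʳ []      u       = u
  Unique-++⁻ʳ (_ ∷ X) (_ ∷ u) = Unique-++⁻ʳ X u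

  Unique-++-disjoint : ∀ (X : List A) {Y x} → Unique (X ++ Y) → x ∈ X → x ∉ Y
  Unique-++-disjoint (_ ∷ X) (x∉ ∷ _) (here refl) x∈Y = All.lookup x∉ (∈-++⁺ʳ X x∈Y) refl
  Unique-++-disjoint (_ ∷ X) (_ ∷ u)  (there x∈X)     = Unique-++-disjoint X u x∈X

  Unique-reverse : ∀ {xs : List A} → Unique xs → Unique (reverse xs)
  Unique-reverse {xs} = Unique-resp-↭ (setoid A) (Perm.↭-sym (setoid A) (↭-reverse (setoid A) xs))

  segment-split : ∀ X M {p q : A} {Y} → X ++ p ∷ M ++ q ∷ Y ≡ X ++ (p ∷ M ++ [ q ]) ++ Y
  segment-split X M {q = q} {Y} = cong (λ Z → X ++ _ ∷ Z) (sym (++-assoc M [ q ] Y))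

module _ {n : ℕ} where

  Diff-infix : ∀ (X : List (Fin n)) {S R Y} → Unique (X ++ S ++ Y) →
               Diff (X ++ S ++ Y) (X ++ R ++ Y) ≐ Diff S R
  Diff-infix X {S} {R} {Y} u = to , from
    where
    to : ∀ {x} → Diff (X ++ S ++ Y) (X ++ R ++ Y) x → Diff S R x
    to (x∈ , x∉) with ∈-++⁻ X x∈
    ... | inj₁ x∈X = ⊥-elim (x∉ (∈-++⁺ˡ x∈X))
    ... | inj₂ x∈SY with ∈-++⁻ S x∈SY
    ...   | inj₁ x∈S = x∈S , x∉ ∘ ∈-++⁺ʳ X ∘ ∈-++⁺ˡ
    ...   | inj₂ x∈Y = ⊥-elim (x∉ (∈-++⁺ʳ X (∈-++⁺ʳ R x∈Y)))
    from : ∀ {x} → Diff S R x → Diff (X ++ S ++ Y) (X ++ R ++ Y) x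
    from (x∈S , x∉R) = ∈-++⁺ʳ X (∈-++⁺ˡ x∈S) , λ x∈ → case (∈-++⁻ X x∈)
      where
      case : _ ⊎ _ → _
      case (inj₁ x∈X)  = Unique-++-disjoint X u x∈X (∈-++⁺ˡ x∈S)
      case (inj₂ x∈RY) = [ x∉R , Unique-++-disjoint S (Unique-++⁻ʳ X u) x∈S ]′ (∈-++⁻ R x∈RY)

  Diff-reverse : ∀ (Q R : List (Fin n)) → Diff (reverse R) Q ≐ Diff R (reverse Q)
  Diff-reverse Q R = (λ (i , j) → Any.reverse⁻ i , j ∘ Any.reverse⁻)
                   , (λ (i , j) → Any.reverse⁺ i , j ∘ Any.reverse⁺)

  IsMinOf-resp-≐ : ∀ {S S′ : Fin n → Set} {m} → S ≐ S′ → IsMinOf S m → IsMinOf S′ m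
  IsMinOf-resp-≐ (to , from) (m∈ , m≤) = to m∈ , λ s s∈ → m≤ s (from s∈)

  Consec-∈ˡ : ∀ {L : List (Fin n)} {c d} → Consec L c d → c ∈ L
  Consec-∈ˡ here      = here refl
  Consec-∈ˡ (there k) = there (Consec-∈ˡ k)

  Consec-∈ʳ : ∀ {L : List (Fin n)} {c d} → Consec L c d → d ∈ L
  Consec-∈ʳ here      = there (here refl)
  Consec-∈ʳ (there k) = there (Consec-∈ʳ k)

  Consec-++⁺ˡ : ∀ {L M : List (Fin n)} {c d} → Consec L c d → Consec (L ++ M) c d
  Consec-++⁺ˡ here      = here
  Consec-++⁺ˡ (there k) = there (Consec-++⁺ˡ k)

  Consec-++⁺ʳ : ∀ (L : List (Fin n)) {M c d} → Consec M c d → Consec (L ++ M) c d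
  Consec-++⁺ʳ []      k = k
  Consec-++⁺ʳ (_ ∷ L) k = there (Consec-++⁺ʳ L k)

  Consec-reverse : ∀ {L : List (Fin n)} {c d} → Consec L c d → Consec (reverse L) d c
  Consec-reverse {x ∷ y ∷ L} here =
    subst (λ Z → Consec Z y x) (sym reverse-xyL) (Consec-++⁺ʳ (reverse L) here)
    where
    reverse-xyL : reverse (x ∷ y ∷ L) ≡ reverse L ++ y ∷ x ∷ []
    reverse-xyL = begin
      reverse (x ∷ y ∷ L)          ≡⟨ unfold-reverse x (y ∷ L) ⟩
      reverse (y ∷ L) ++ [ x ]     ≡⟨ cong (_++ [ x ]) (unfold-reverse y L) ⟩
      (reverse L ++ [ y ]) ++ [ x ] ≡⟨ ++-assoc (reverse L) [ y ] [ x ] ⟩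
      reverse L ++ y ∷ x ∷ []      ∎
      where open ≡-Reasoning
  Consec-reverse {z ∷ L} (there k) =
    subst (λ Z → Consec Z _ _) (sym (unfold-reverse z L)) (Consec-++⁺ˡ (Consec-reverse k))

  Consec-split : ∀ {L : List (Fin n)} {c d} → Consec L c d → ∃ λ X → ∃ λ Y → L ≡ X ++ c ∷ d ∷ Y
  Consec-split here = [] , _ , refl
  Consec-split (there k) with X , Y , refl ← Consec-split k = _ ∷ X , Y , refl

  numEdges-< : ∀ {x : Fin n} T (L : List (Fin n)) →
               length (x ∷ T) <ℕ length L → numEdges (x ∷ T) <ℕ numEdges L
  numEdges-< _ (_ ∷ _) (s≤s T<L) = T<L

  PathEdge-sym : ∀ {P : List (Fin n)} {c d} → PathEdge P c d → PathEdge P d c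
  PathEdge-sym (inj₁ k) = inj₂ k
  PathEdge-sym (inj₂ k) = inj₁ k

  SubpathOf : List (Fin n) → List (Fin n) → Set
  SubpathOf S P = (∀ {x} → x ∈ S → x ∈ P) × (∀ {c d} → Consec S c d → PathEdge P c d)

  infix-subpath : ∀ X S Y → SubpathOf S (X ++ S ++ Y)
  infix-subpath X S Y = ∈-++⁺ʳ X ∘ ∈-++⁺ˡ , inj₁ ∘ Consec-++⁺ʳ X ∘ Consec-++⁺ˡ

  reverse-subpath : ∀ {S P} → SubpathOf S P → SubpathOf (reverse S) P
  reverse-subpath {S} (⊆P , edges) =
    ⊆P ∘ Any.reverse⁻ ,
    PathEdge-sym ∘ edges ∘ subst (λ Z → Consec Z _ _) (reverse-involutive S) ∘ Consec-reverse

module Walks {n : ℕ} (G : Graph n) where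

  adj-sym : ∀ {x y} → Adj G x y → Adj G y x
  adj-sym {x} {y} = subst T (Graph.sym G x y)

  walk-head : ∀ {a b x xs} → IsWalk G a b (x ∷ xs) → a ≡ x
  walk-head (single _) = refl
  walk-head (cons _ _) = refl

  walk-start-∈ : ∀ {a b W} → IsWalk G a b W → a ∈ W
  walk-start-∈ (single _) = here refl
  walk-start-∈ (cons _ _) = here refl

  walk-end-∈ : ∀ {a b W} → IsWalk G a b W → b ∈ W
  walk-end-∈ (single _)  = here refl
  walk-end-∈ (cons _ wW) = there (walk-end-∈ wW)

  walk-nonempty : ∀ {a b W} → IsWalk G a b W → ∃ λ W′ → W ≡ a ∷ W′
  walk-nonempty (single _) = [] , refl
  walk-nonempty (cons _ _) = _ , refl

  walk-Consec-adj : ∀ {a b W c d} → IsWalk G a b W → Consec W c d → Adj G c d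
  walk-Consec-adj (cons adj wW) here with refl ← walk-head wW = adj
  walk-Consec-adj (cons _ wW) (there k) = walk-Consec-adj wW k

  walk-split : ∀ X {a b c Y} → IsWalk G a b (X ++ c ∷ Y) →
               IsWalk G a c (X ++ [ c ]) × IsWalk G c b (c ∷ Y)
  -- Peeling a second element makes the list visibly longer than one, ruling out single.
  walk-split []          wW with refl ← walk-head wW = single _ , wW
  walk-split (_ ∷ [])    (cons adj wW) = let wX , wY = walk-split [] wW in cons adj wX , wY
  walk-split (_ ∷ _ ∷ X) (cons adj wW) = let wX , wY = walk-split (_ ∷ X) wW in cons adj wX , wY

  walk-glue : ∀ {a c b W Y} → IsWalk G a c W → IsWalk G c b (c ∷ Y) → IsWalk G a b (W ++ Y)
  walk-glue (single _)   wY = wY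
  walk-glue (cons adj wW) wY = cons adj (walk-glue wW wY)

  walk-last : ∀ {a b W} → IsWalk G a b W → ∃ λ W₀ → W ≡ W₀ ++ [ b ]
  walk-last (single _) = [] , refl
  walk-last (cons _ wW) with W₀ , refl ← walk-last wW = _ ∷ W₀ , refl

  walk-infix⁻ : ∀ X {a b p q S Y} → IsWalk G a b (X ++ S ++ Y) → IsWalk G p q S →
                IsWalk G a p (X ++ [ p ]) × IsWalk G q b (q ∷ Y)
  walk-infix⁻ X {a} {b} {q = q} {Y = Y} wW wS
    with _ , refl ← walk-nonempty wS | S₀ , S≡ ← walk-last wS =
    proj₁ (walk-split X wW) , proj₂ (walk-split (X ++ S₀) (subst (IsWalk G a b) W≡ wW))
    where
    open ≡-Reasoning
    W≡ : X ++ (_ ∷ _) ++ Y ≡ (X ++ S₀) ++ q ∷ Y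
    W≡ = begin
      X ++ (_ ∷ _) ++ Y      ≡⟨ cong (λ Z → X ++ Z ++ Y) S≡ ⟩
      X ++ (S₀ ++ [ q ]) ++ Y ≡⟨ cong (X ++_) (++-assoc S₀ [ q ] Y) ⟩
      X ++ S₀ ++ q ∷ Y       ≡⟨ ++-assoc X S₀ (q ∷ Y) ⟨
      (X ++ S₀) ++ q ∷ Y     ∎

  walk-infix⁺ : ∀ X {a b p q R Y} → IsWalk G a p (X ++ [ p ]) → IsWalk G p q R →
                IsWalk G q b (q ∷ Y) → IsWalk G a b (X ++ R ++ Y)
  walk-infix⁺ X {a} {b} {p} {Y = Y} wX wR wY with R₁ , refl ← walk-nonempty wR =
    subst (IsWalk G a b) (++-assoc X [ p ] (R₁ ++ Y)) (walk-glue wX (walk-glue wR wY))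

  walk-segment : ∀ X M {a b p q Y} → IsWalk G a b (X ++ p ∷ M ++ q ∷ Y) →
                 IsWalk G p q (p ∷ M ++ [ q ])
  walk-segment X M wW = proj₁ (walk-split (_ ∷ M) (proj₂ (walk-split X wW)))

  walk-between-∈ : ∀ {a b P p q} → IsWalk G a b P → p ∈ P → q ∈ P →
    ∃ λ X → ∃ λ T → ∃ λ Y → P ≡ X ++ T ++ Y × (IsWalk G p q T ⊎ IsWalk G q p T)
  walk-between-∈ {a} {b} {p = p} {q} wP p∈ q∈
    with X , Y₀ , refl ← ∈-∃++ p∈ with ∈-++⁻ X q∈
  ... | inj₁ q∈X with X₁ , M , refl ← ∈-∃++ q∈X =
    X₁ , _ , Y₀ , trans P≡ (segment-split X₁ M) ,
    inj₂ (walk-segment X₁ M (subst (IsWalk G a b) P≡ wP))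
    where
    P≡ : (X₁ ++ q ∷ M) ++ p ∷ Y₀ ≡ X₁ ++ q ∷ M ++ p ∷ Y₀
    P≡ = ++-assoc X₁ (q ∷ M) (p ∷ Y₀)
  ... | inj₂ (here refl) = X , [ _ ] , Y₀ , refl , inj₁ (single _)
  ... | inj₂ (there q∈Y₀) with M , Y , refl ← ∈-∃++ q∈Y₀ =
    X , _ , Y , segment-split X M , inj₁ (walk-segment X M wP)

  walk-reverse : ∀ {a b W} → IsWalk G a b W → IsWalk G b a (reverse W)
  walk-reverse (single a) = single a
  walk-reverse {a} (cons {vs = W} adj wW) =
    subst (IsWalk G _ a) (sym (unfold-reverse a W))
      (walk-glue (walk-reverse wW) (cons (adj-sym adj) (single a)))

  walk⇒reach : ∀ {allowed : Fin n → Set} {a b W} →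
               All allowed W → IsWalk G a b W → ReachIn G allowed a b
  walk⇒reach (ok ∷ [])  (single _)   = here ok
  walk⇒reach (ok ∷ oks) (cons adj wW) = step ok adj (walk⇒reach oks wW)

  reach-start : ∀ {allowed : Fin n → Set} {x y} → ReachIn G allowed x y → allowed x
  reach-start (here ok)     = ok
  reach-start (step ok _ _) = ok

  reach-end : ∀ {allowed : Fin n → Set} {x y} → ReachIn G allowed x y → allowed y
  reach-end (here ok)    = ok
  reach-end (step _ _ r) = reach-end r

  reach-mono : ∀ {A B : Fin n → Set} → (∀ {x} → A x → B x) →
               ∀ {x y} → ReachIn G A x y → ReachIn G B x y
  reach-mono A⊆B (here ok)       = here (A⊆B ok)
  reach-mono A⊆B (step ok adj r) = step (A⊆B ok) adj (reach-mono A⊆B r)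

  reach-trans : ∀ {allowed : Fin n → Set} {x y z} →
                ReachIn G allowed x y → ReachIn G allowed y z → ReachIn G allowed x z
  reach-trans (here _)        r′ = r′
  reach-trans (step ok adj r) r′ = step ok adj (reach-trans r r′)

  reach-sym : ∀ {allowed : Fin n → Set} {x y} → ReachIn G allowed x y → ReachIn G allowed y x
  reach-sym (here ok)       = here ok
  reach-sym (step ok adj r) = reach-trans (reach-sym r) (step (reach-start r) (adj-sym adj) (here ok))

module Comparison {n : ℕ} (w : Weights n) where

  weight : List (Fin n) → ℕ
  weight = pathWeight w

  weight-++-∷ : ∀ (L : List (Fin n)) {m M} →
                weight (L ++ m ∷ M) ≡ weight (L ++ [ m ]) + weight (m ∷ M)
  weight-++-∷ []              = refl
  weight-++-∷ (x ∷ [])        {m} {M} = cong (_+ weight (m ∷ M)) (sym (+-identityʳ (w x m)))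
  weight-++-∷ (x ∷ L@(y ∷ _)) = trans (cong (w x y +_) (weight-++-∷ L)) (sym (+-assoc (w x y) _ _))

  weight-suffix : ∀ (L : List (Fin n)) {m M} → weight (m ∷ M) ≤ℕ weight (L ++ m ∷ M)
  weight-suffix L = ≤-trans (m≤n+m _ _) (≤-reflexive (sym (weight-++-∷ L)))

  Cheaper : List (Fin n) → List (Fin n) → Set
  Cheaper Q Q′ = weight Q <ℕ weight Q′
               ⊎ (weight Q′ ≡ weight Q × numEdges Q <ℕ numEdges Q′)

  _≼_ : List (Fin n) → List (Fin n) → Set
  Q ≼ Q′ = weight Q ≤ℕ weight Q′ × (weight Q′ ≡ weight Q → numEdges Q ≤ℕ numEdges Q′)

  ≼-refl : ∀ {Q} → Q ≼ Q
  ≼-refl = ≤-refl , λ _ → ≤-refl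

  Cheaper⇒LexWorse : ∀ {Q Q′} → Cheaper Q Q′ → LexWorse w Q Q′
  Cheaper⇒LexWorse = [ inj₁ , inj₂ ∘ inj₁ ]′

  LexWorse⇒≼ : ∀ {Q Q′} → LexWorse w Q Q′ → Q ≼ Q′
  LexWorse⇒≼ (inj₁ <w)                 = <⇒≤ <w , λ ≡w → ⊥-elim (<-irrefl (sym ≡w) <w)
  LexWorse⇒≼ (inj₂ (inj₁ (≡w , <e)))    = ≤-reflexive (sym ≡w) , λ _ → <⇒≤ <e
  LexWorse⇒≼ (inj₂ (inj₂ (≡w , ≡e , _))) = ≤-reflexive (sym ≡w) , λ _ → ≤-reflexive (sym ≡e)

  LexWorse-asym : ∀ {Q Q′} → LexWorse w Q Q′ → ¬ LexWorse w Q′ Q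
  LexWorse-asym (inj₁ <w) worse′ = ≤⇒≯ (proj₁ (LexWorse⇒≼ worse′)) <w
  LexWorse-asym (inj₂ (inj₁ (≡w , <e))) worse′ = ≤⇒≯ (proj₂ (LexWorse⇒≼ worse′) (sym ≡w)) <e
  LexWorse-asym (inj₂ (inj₂ (≡w , _))) (inj₁ <w) = <-irrefl ≡w <w
  LexWorse-asym (inj₂ (inj₂ (_ , ≡e , _))) (inj₂ (inj₁ (_ , <e))) = <-irrefl ≡e <e
  LexWorse-asym (inj₂ (inj₂ (_ , _ , m′ , m , min′ , min , m<m′)))
                (inj₂ (inj₂ (_ , _ , k′ , k , kmin′ , kmin , k<k′))) =
    <-irrefl refl
      (<-≤-trans (<-trans (<-≤-trans m<m′ (proj₂ min′ k (proj₁ kmin))) k<k′) (proj₂ kmin′ m (proj₁ min)))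

  record Shifted (δ k : ℕ) (Q S : List (Fin n)) : Set where
    constructor shifted
    field
      weight-shift : weight Q ≡ δ + weight S
      edges-shift  : numEdges Q ≡ k + numEdges S

  private
    unshift-≡ : ∀ δ {x y x′ y′} → x′ ≡ δ + x → y′ ≡ δ + y → y′ ≡ x′ → y ≡ x
    unshift-≡ δ x′≡ y′≡ y′≡x′ = +-cancelˡ-≡ δ _ _ (trans (sym y′≡) (trans y′≡x′ x′≡))

    unshift-< : ∀ δ {x y x′ y′} → x′ ≡ δ + x → y′ ≡ δ + y → x′ <ℕ y′ → x <ℕ y
    unshift-< δ x′≡ y′≡ x′<y′ = +-cancelˡ-< δ _ _ (subst₂ _<ℕ_ x′≡ y′≡ x′<y′)

  Cheaper-unshift : ∀ {δ k Q S Q′ R} → Shifted δ k Q S → Shifted δ k Q′ R →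
                    Cheaper Q Q′ → Cheaper S R
  Cheaper-unshift {δ} (shifted wQ _) (shifted wQ′ _) (inj₁ <w) = inj₁ (unshift-< δ wQ wQ′ <w)
  Cheaper-unshift {δ} {k} (shifted wQ eQ) (shifted wQ′ eQ′) (inj₂ (≡w , <e)) =
    inj₂ (unshift-≡ δ wQ wQ′ ≡w , unshift-< k eQ eQ′ <e)

  LexWorse-unshift : ∀ {δ k Q S Q′ R} → Shifted δ k Q S → Shifted δ k Q′ R →
                     Diff Q′ Q ≐ Diff R S → Diff Q Q′ ≐ Diff S R → LexWorse w Q Q′ → LexWorse w S R
  LexWorse-unshift sQ sQ′ _ _ (inj₁ <w) = Cheaper⇒LexWorse (Cheaper-unshift sQ sQ′ (inj₁ <w))
  LexWorse-unshift sQ sQ′ _ _ (inj₂ (inj₁ c)) = Cheaper⇒LexWorse (Cheaper-unshift sQ sQ′ (inj₂ c))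
  LexWorse-unshift {δ} {k} (shifted wQ eQ) (shifted wQ′ eQ′) D′ D
                   (inj₂ (inj₂ (≡w , ≡e , m′ , m , min′ , min , m<m′))) =
    inj₂ (inj₂ (unshift-≡ δ wQ wQ′ ≡w , unshift-≡ k eQ eQ′ ≡e , m′ , m ,
                IsMinOf-resp-≐ D′ min′ , IsMinOf-resp-≐ D min , m<m′))

module LexShortestPaths {n : ℕ} (G : Graph n) (w : Weights n) where

  open Walks G
  open Comparison w

  open DecMembership (_≟_ {n}) using (_∈?_)

  lsp-walk : ∀ {a b Q} → IsLSP G w a b Q → IsWalk G a b Q
  lsp-walk = proj₁ ∘ proj₁

  weight-∷ : ∀ {y b W} → IsWalk G y b W → ∀ x → weight (x ∷ W) ≡ w x y + weight W
  weight-∷ (single _) _ = refl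
  weight-∷ (cons _ _) _ = refl

  weight-++ : ∀ {p q S} → IsWalk G p q S → ∀ Y → weight (S ++ Y) ≡ weight S + weight (q ∷ Y)
  weight-++ (single _) _ = refl
  weight-++ {p} (cons {b = y} _ wS) Y with _ , refl ← walk-nonempty wS =
    trans (cong (w p y +_) (weight-++ wS Y)) (sym (+-assoc (w p y) _ _))

  infix-shifted : ∀ X {p q S Y} → IsWalk G p q S →
    Shifted (weight (X ++ [ p ]) + weight (q ∷ Y)) (length X + length Y) (X ++ S ++ Y) S
  infix-shifted X {p} {q} {Y = Y} wS with S₁ , refl ← walk-nonempty wS = shifted weight-shift edges-shift
    where
    open ≡-Reasoning
    weight-shift : weight (X ++ p ∷ S₁ ++ Y)
                 ≡ weight (X ++ [ p ]) + weight (q ∷ Y) + weight (p ∷ S₁)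
    weight-shift = begin
      weight (X ++ p ∷ S₁ ++ Y)                                        ≡⟨ weight-++-∷ X ⟩
      weight (X ++ [ p ]) + weight (p ∷ S₁ ++ Y)                   ≡⟨ cong (_ +_) (weight-++ wS Y) ⟩
      weight (X ++ [ p ]) + (weight (p ∷ S₁) + weight (q ∷ Y)) ≡⟨ x∙yz≈xz∙y (weight (X ++ [ p ])) _ _ ⟩
      weight (X ++ [ p ]) + weight (q ∷ Y) + weight (p ∷ S₁)   ∎
    edges-shift : numEdges (X ++ p ∷ S₁ ++ Y) ≡ length X + length Y + length S₁
    edges-shift = begin
      length (X ++ p ∷ S₁ ++ Y) ∸ 1            ≡⟨ cong (_∸ 1) (length-++ X) ⟩
      length X + suc (length (S₁ ++ Y)) ∸ 1    ≡⟨ cong (_∸ 1) (+-suc (length X) _) ⟩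
      length X + length (S₁ ++ Y)              ≡⟨ cong (length X +_) (length-++ S₁) ⟩
      length X + (length S₁ + length Y)        ≡⟨ x∙yz≈xz∙y (length X) (length S₁) _ ⟩
      length X + length Y + length S₁          ∎

  reverse-shifted : SymOnEdges G w → ∀ {a b W} → IsWalk G a b W → Shifted 0 0 (reverse W) W
  reverse-shifted w-sym {W = W} wW = shifted (weight-reverse wW) (cong (_∸ 1) (length-reverse W))
    where
    weight-reverse : ∀ {a b W} → IsWalk G a b W → weight (reverse W) ≡ weight W
    weight-reverse (single _) = refl
    weight-reverse {a} (cons {b = y} {vs = W} adj wW) = begin
      weight (reverse (a ∷ W))                     ≡⟨ cong weight (unfold-reverse a W) ⟩
      weight (reverse W ++ [ a ])                  ≡⟨ weight-++ (walk-reverse wW) [ a ] ⟩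
      weight (reverse W) + (w y a + 0)             ≡⟨ cong₂ _+_ (weight-reverse wW) (+-identityʳ (w y a)) ⟩
      weight W + w y a                             ≡⟨ +-comm _ (w y a) ⟩
      w y a + weight W                             ≡⟨ cong (_+ weight W) (w-sym y a (adj-sym adj)) ⟩
      w a y + weight W                             ≡⟨ weight-∷ wW a ⟨
      weight (a ∷ W)                               ∎
      where open ≡-Reasoning

  walk⇒path : ∀ {a b W} → IsWalk G a b W →
    Σ (List (Fin n)) λ W* →
      IsPath G a b W* × weight W* ≤ℕ weight W × (W* ≡ W ⊎ length W* <ℕ length W)
  walk⇒path (single a) = [ a ] , (single a , [] ∷ []) , ≤-refl , inj₁ refl
  walk⇒path {a} (cons {b = y} {vs = W} adj wW) with walk⇒path wW
  ... | W* , (wW* , uW*) , W*≤W , W*≡∨<W with a ∈? W*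
  ... | no a∉W* =
    a ∷ W* , (cons adj wW* , Unique-∷ a∉W* uW*) , weight≤ , [ inj₁ ∘ cong (a ∷_) , inj₂ ∘ s≤s ]′ W*≡∨<W
    where
    weight≤ : weight (a ∷ W*) ≤ℕ weight (a ∷ W)
    weight≤ = subst₂ _≤ℕ_ (sym (weight-∷ wW* a)) (sym (weight-∷ wW a)) (+-monoʳ-≤ (w a y) W*≤W)
  ... | yes a∈W* with L , M , refl ← ∈-∃++ a∈W* =
    a ∷ M , (proj₂ (walk-split L wW*) , Unique-++⁻ʳ L uW*) , weight≤ , inj₂ (s≤s length≤)
    where
    weight≤ : weight (a ∷ M) ≤ℕ weight (a ∷ W)
    weight≤ = ≤-trans (weight-suffix L)
                (≤-trans W*≤W (≤-trans (m≤n+m _ (w a y)) (≤-reflexive (sym (weight-∷ wW a)))))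
    length≤ : length (a ∷ M) ≤ℕ length W
    length≤ = ≤-trans (m≤n+m _ (length L))
                (≤-trans (≤-reflexive (sym (length-++ L)))
                  ([ ≤-reflexive ∘ cong length , <⇒≤ ]′ W*≡∨<W))

  lsp-minimal : ∀ {a b Q Q′} → IsLSP G w a b Q → IsPath G a b Q′ → Q ≼ Q′
  lsp-minimal {Q = Q} {Q′} (_ , beats) pQ′ with ≡-dec _≟_ Q′ Q
  ... | yes refl   = ≼-refl {Q}
  ... | no  Q′≢Q = LexWorse⇒≼ (beats Q′ pQ′ Q′≢Q)

  lsp-unique : ∀ {a b Q Q′} → IsLSP G w a b Q → IsLSP G w a b Q′ → Q ≡ Q′
  lsp-unique {Q = Q} {Q′} (pQ , beats) (pQ′ , beats′) with ≡-dec _≟_ Q Q′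
  ... | yes Q≡Q′ = Q≡Q′
  ... | no  Q≢Q′ = ⊥-elim (LexWorse-asym (beats Q′ pQ′ (Q≢Q′ ∘ sym)) (beats′ Q pQ Q≢Q′))

  lsp-cheaper-than-nonpath : ∀ {a b Q W} → IsLSP G w a b Q → IsWalk G a b W → ¬ Unique W →
                             Cheaper Q W
  lsp-cheaper-than-nonpath {a} {Q = Q} {W} lQ wW ¬uW with walk⇒path wW
  ... | W* , pW* , W*≤W , inj₁ refl = ⊥-elim (¬uW (proj₂ pW*))
  ... | W* , pW* , W*≤W , inj₂ W*<W with lsp-minimal lQ pW*
  ...   | Q≤W* , Q≤W*-edges with m≤n⇒m<n∨m≡n (≤-trans Q≤W* W*≤W)
  ...     | inj₁ Q<W = inj₁ Q<W
  ...     | inj₂ Q≡W with T , refl ← walk-nonempty (proj₁ pW*) =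
    inj₂ (sym Q≡W , ≤-<-trans (Q≤W*-edges W*≡Q) (numEdges-< {x = a} T W W*<W))
    where
    W*≡Q : weight W* ≡ weight Q
    W*≡Q = ≤-antisym (≤-trans W*≤W (≤-reflexive (sym Q≡W))) Q≤W*

  lsp-infix : ∀ X {a b p q S Y} → IsLSP G w a b (X ++ S ++ Y) → IsWalk G p q S → IsLSP G w p q S
  lsp-infix X {a} {b} {p} {q} {S} {Y} lW@((wW , uW) , beats) wS =
    (wS , Unique-++⁻ˡ S (Unique-++⁻ʳ X uW)) , beats-S
    where
    replace : ∀ {R} → IsWalk G p q R → IsWalk G a b (X ++ R ++ Y)
    replace wR = let wX , wY = walk-infix⁻ X wW wS in walk-infix⁺ X wX wR wY

    -- If X ++ R ++ Y repeats a vertex it is not a competitor of the lsp, but its shortcut is.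
    beats-S : ∀ R → IsPath G p q R → R ≢ S → LexWorse w S R
    beats-S R (wR , _) R≢S with DecUnique.unique? _≟_ (X ++ R ++ Y)
    ... | yes uW′ =
      LexWorse-unshift (infix-shifted X wS) (infix-shifted X wR) (Diff-infix X uW′) (Diff-infix X uW)
        (beats _ (replace wR , uW′) (R≢S ∘ ++-cancelʳ Y _ _ ∘ ++-cancelˡ X _ _))
    ... | no ¬uW′ =
      Cheaper⇒LexWorse (Cheaper-unshift (infix-shifted X wS) (infix-shifted X wR)
        (lsp-cheaper-than-nonpath lW (replace wR) ¬uW′))

  lsp-segment : ∀ X M {a b p q Y} → IsLSP G w a b (X ++ p ∷ M ++ q ∷ Y) →
                IsLSP G w p q (p ∷ M ++ [ q ])
  lsp-segment X M lW = lsp-infix X (subst (IsLSP G w _ _) (segment-split X M) lW) (walk-segment X M (lsp-walk lW))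

  lsp-reverse : SymOnEdges G w → ∀ {a b Q} → IsLSP G w a b Q → IsLSP G w b a (reverse Q)
  lsp-reverse w-sym {a} {b} {Q} ((wQ , uQ) , beats) = (walk-reverse wQ , Unique-reverse uQ) , beats-reverse
    where
    shift-Q : Shifted 0 0 Q (reverse Q)
    shift-Q = subst (λ Z → Shifted 0 0 Z (reverse Q)) (reverse-involutive Q)
                (reverse-shifted w-sym (walk-reverse wQ))

    beats-reverse : ∀ R → IsPath G b a R → R ≢ reverse Q → LexWorse w (reverse Q) R
    beats-reverse R (wR , uR) R≢ =
      LexWorse-unshift shift-Q (reverse-shifted w-sym wR) (Diff-reverse Q R) (≐-sym (Diff-reverse R Q))
        (beats (reverse R) (walk-reverse wR , Unique-reverse uR) (R≢ ∘ sym ∘ reverse-selfInverse))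

  lsp-subpath-of-lsp : SymOnEdges G w → ∀ {u v P p q S} → IsLSP G w u v P → IsLSP G w p q S →
               p ∈ P → q ∈ P → SubpathOf S P
  lsp-subpath-of-lsp w-sym lP lS p∈ q∈ with walk-between-∈ (lsp-walk lP) p∈ q∈
  ... | X , T , Y , refl , inj₁ wT =
    subst (λ Z → SubpathOf Z _) (lsp-unique (lsp-infix X lP wT) lS) (infix-subpath X T Y)
  ... | X , T , Y , refl , inj₂ wT =
    subst (λ Z → SubpathOf Z _)
      (reverse-selfInverse (sym (lsp-unique (lsp-infix X lP wT) (lsp-reverse w-sym lS))))
      (reverse-subpath (infix-subpath X T Y))

  lsp-reach-avoiding : SymOnEdges G w → ∀ {u v P a b} A {c} B →
                       IsLSP G w u v P → IsLSP G w a b (A ++ c ∷ B) → c ∉ P →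
                       ReachIn G (_∉ P) a c ⊎ ReachIn G (_∉ P) c b
  lsp-reach-avoiding w-sym {P = P} A {c} B lP lQ c∉P with any? (_∈? P) A | any? (_∈? P) B
  ... | no A∌ | _ =
    inj₁ (walk⇒reach (All.++⁺ (All.¬Any⇒All¬ A A∌) (c∉P ∷ [])) (proj₁ (walk-split A (lsp-walk lQ))))
  ... | yes _ | no B∌ =
    inj₂ (walk⇒reach (c∉P ∷ All.¬Any⇒All¬ B B∌) (proj₂ (walk-split A (lsp-walk lQ))))
  ... | yes A∋ | yes B∋
    with p , p∈A , p∈P ← find A∋ | q , q∈B , q∈P ← find B∋
    with A₁ , A₂ , refl ← ∈-∃++ p∈A | B₁ , B₂ , refl ← ∈-∃++ q∈B =
    ⊥-elim (c∉P (proj₁ (lsp-subpath-of-lsp w-sym lP segment p∈P q∈P) c∈segment))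
    where
    Q≡ : (A₁ ++ p ∷ A₂) ++ c ∷ B₁ ++ q ∷ B₂ ≡ A₁ ++ p ∷ (A₂ ++ c ∷ B₁) ++ q ∷ B₂
    Q≡ = trans (++-assoc A₁ (p ∷ A₂) (c ∷ B₁ ++ q ∷ B₂))
               (cong (λ Z → A₁ ++ p ∷ Z) (sym (++-assoc A₂ (c ∷ B₁) (q ∷ B₂))))
    segment : IsLSP G w p q (p ∷ (A₂ ++ c ∷ B₁) ++ [ q ])
    segment = lsp-segment A₁ (A₂ ++ c ∷ B₁) (subst (IsLSP G w _ _) Q≡ lQ)
    c∈segment : c ∈ p ∷ (A₂ ++ c ∷ B₁) ++ [ q ]
    c∈segment = there (∈-++⁺ˡ (∈-++⁺ʳ A₂ (here refl)))

module Component {n : ℕ} (G : Graph n) (u v h : Fin n) where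

  open Walks G

  InH-step : ∀ {x y} → InH G u v h x → Adj G x y → InH G u v h y ⊎ (y ≡ u ⊎ y ≡ v)
  InH-step {y = y} x∈H adj with y ≟ u | y ≟ v
  ... | yes y≡u | _       = inj₂ (inj₁ y≡u)
  ... | no _    | yes y≡v = inj₂ (inj₂ y≡v)
  ... | no y≢u  | no y≢v  = inj₁ (reach-trans x∈H (step (reach-end x∈H) adj (here (y≢u , y≢v))))

  E₁-sym : ∀ {P c d} → E₁ G u v h P c d → E₁ G u v h P d c
  E₁-sym (inj₁ (adj , c∈H , d∈H))          = inj₁ (adj-sym adj , d∈H , c∈H)
  E₁-sym (inj₂ (inj₁ e))                   = inj₂ (inj₁ (PathEdge-sym e))
  E₁-sym (inj₂ (inj₂ (adj , inj₁ c∈H-d∈uv))) = inj₂ (inj₂ (adj-sym adj , inj₂ c∈H-d∈uv))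
  E₁-sym (inj₂ (inj₂ (adj , inj₂ d∈H-c∈uv))) = inj₂ (inj₂ (adj-sym adj , inj₁ d∈H-c∈uv))

module Separation {n : ℕ} (G : Graph n) (w : Weights n) (w-sym : SymOnEdges G w)
                  {u v : Fin n} {P : List (Fin n)} (lP : IsLSP G w u v P) (h : Fin n) where

  open Walks G
  open LexShortestPaths G w
  open Component G u v h

  open DecMembership (_≟_ {n}) using (_∈?_)

  avoiding⇒outside : ∀ {x y} → ReachIn G (_∉ P) x y → ReachIn G (Outside u v) x y
  avoiding⇒outside = reach-mono λ x∉P → (λ { refl → x∉P (walk-start-∈ (lsp-walk lP)) })
                                       , (λ { refl → x∉P (walk-end-∈ (lsp-walk lP)) })

  V₁∖P⇒InH : ∀ {x} → V₁ G u v h P x → x ∉ P → InH G u v h x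
  V₁∖P⇒InH (inj₁ x∈H) _   = x∈H
  V₁∖P⇒InH (inj₂ x∈P) x∉P = ⊥-elim (x∉P x∈P)

  lsp-vertex-in-V₁ : ∀ {a b Q c} → V₁ G u v h P a → V₁ G u v h P b → IsLSP G w a b Q →
                     c ∈ Q → V₁ G u v h P c
  lsp-vertex-in-V₁ {c = c} a∈V₁ b∈V₁ lQ c∈Q with c ∈? P
  ... | yes c∈P = inj₂ c∈P
  ... | no  c∉P with A , B , refl ← ∈-∃++ c∈Q with lsp-reach-avoiding w-sym A B lP lQ c∉P
  ...   | inj₁ a⇝c = inj₁ (reach-trans (V₁∖P⇒InH a∈V₁ (reach-start a⇝c)) (avoiding⇒outside a⇝c))
  ...   | inj₂ c⇝b =
    inj₁ (reach-trans (V₁∖P⇒InH b∈V₁ (reach-end c⇝b)) (reach-sym (avoiding⇒outside c⇝b)))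

  lsp-edge-in-E₁ : ∀ {a b Q c d} → V₁ G u v h P a → V₁ G u v h P b → IsLSP G w a b Q →
                   Consec Q c d → E₁ G u v h P c d
  lsp-edge-in-E₁ a∈V₁ b∈V₁ lQ k
    with lsp-vertex-in-V₁ a∈V₁ b∈V₁ lQ (Consec-∈ˡ k) | lsp-vertex-in-V₁ a∈V₁ b∈V₁ lQ (Consec-∈ʳ k)
       | walk-Consec-adj (lsp-walk lQ) k
  ... | inj₁ c∈H | _ | adj =
    [ (λ d∈H → inj₁ (adj , c∈H , d∈H)) , (λ d∈uv → inj₂ (inj₂ (adj , inj₁ (c∈H , d∈uv)))) ]′
      (InH-step c∈H adj)
  ... | inj₂ _ | inj₁ d∈H | adj =
    [ (λ c∈H → inj₁ (adj , c∈H , d∈H)) , (λ c∈uv → inj₂ (inj₂ (adj , inj₂ (d∈H , c∈uv)))) ]′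
      (InH-step d∈H (adj-sym adj))
  ... | inj₂ c∈P | inj₂ d∈P | _ with X , Y , refl ← Consec-split k =
    inj₂ (inj₁ (proj₂ (lsp-subpath-of-lsp w-sym lP (lsp-segment X [] lQ) c∈P d∈P) here))

  lsp-in-G₁ : ∀ a b → V₁ G u v h P a → V₁ G u v h P b → ∀ Q → IsLSP G w a b Q →
              ContainedIn Q (V₁ G u v h P) (E₁ G u v h P)
  lsp-in-G₁ a b a∈V₁ b∈V₁ Q lQ =
    All.tabulate (lsp-vertex-in-V₁ a∈V₁ b∈V₁ lQ) ,
    λ c d → [ lsp-edge-in-E₁ a∈V₁ b∈V₁ lQ , E₁-sym ∘ lsp-edge-in-E₁ a∈V₁ b∈V₁ lQ ]′

  module _ (P∩H≡∅ : ∀ x → x ∈ P → ¬ InH G u v h x) where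

    lsp-vertex-in-V₂ : ∀ {a b Q c} → V₂ G u v h a → V₂ G u v h b → IsLSP G w a b Q →
                       c ∈ Q → V₂ G u v h c
    lsp-vertex-in-V₂ {c = c} a∉H b∉H lQ c∈Q c∈H with A , B , refl ← ∈-∃++ c∈Q
      with lsp-reach-avoiding w-sym A B lP lQ (λ c∈P → P∩H≡∅ c c∈P c∈H)
    ... | inj₁ a⇝c = a∉H (reach-trans c∈H (reach-sym (avoiding⇒outside a⇝c)))
    ... | inj₂ c⇝b = b∉H (reach-trans c∈H (avoiding⇒outside c⇝b))

    lsp-in-G₂ : ∀ a b → V₂ G u v h a → V₂ G u v h b → ∀ Q → IsLSP G w a b Q →
                ContainedIn Q (V₂ G u v h) (E₂ G u v h)
    lsp-in-G₂ a b a∉H b∉H Q lQ = All.tabulate in-V₂ , λ c d → [ forward , backward ]′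
      where
      in-V₂ : ∀ {c} → c ∈ Q → V₂ G u v h c
      in-V₂ = lsp-vertex-in-V₂ a∉H b∉H lQ
      forward : ∀ {c d} → Consec Q c d → E₂ G u v h c d
      forward k = walk-Consec-adj (lsp-walk lQ) k , in-V₂ (Consec-∈ˡ k) , in-V₂ (Consec-∈ʳ k)
      backward : ∀ {c d} → Consec Q d c → E₂ G u v h c d
      backward k = adj-sym (walk-Consec-adj (lsp-walk lQ) k) , in-V₂ (Consec-∈ʳ k) , in-V₂ (Consec-∈ˡ k)

lemma7 : ∀ {n} (G : Graph n) (w : Weights n) → SymOnEdges G w →
    Connected G → Partial2Tree G → ¬ Outerplanar G →
    ∀ (u v : Fin n) →
    (Σ (Fin n) λ x → Σ (Fin n) λ y → Σ (Fin n) λ z → HasK23Subdivision G u v x y z) →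
    AtLeast3Components G u v →
    ∀ (P : List (Fin n)) → IsLSP G w u v P →
    ∀ (h : Fin n) → Outside u v h →
    (∀ x → x ∈ P → ¬ InH G u v h x) →
    (∀ a b → PathEdge P a b → ¬ EdgeH G u v h a b) →
    (∀ a b → V₁ G u v h P a → V₁ G u v h P b → ∀ Q → IsLSP G w a b Q →
       ContainedIn Q (V₁ G u v h P) (E₁ G u v h P))
    × (∀ a b → V₂ G u v h a → V₂ G u v h b → ∀ Q → IsLSP G w a b Q →
       ContainedIn Q (V₂ G u v h) (E₂ G u v h))
lemma7 G w w-sym _ _ _ u v _ _ P lP h _ P∩H≡∅ _ =
  Separation.lsp-in-G₁ G w w-sym lP h , Separation.lsp-in-G₂ G w w-sym lP h P∩H≡∅
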